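{- Let $H$ be a graph with $\mathrm{mad}(H)\leq\frac{18}{7}$, let $k\geq 0$ be an integer and let $u,v\in V(H)$ with $\rho^*_H(\{u,v\})\geq 7-2k$. Let $H'$ be the graph obtained from $H$ by adding a new path $P$ between $u$ and $v$ whose $k$ internal vertices are new vertices of degree $2$ (when $k=0$, $P$ is just a new edge $uv$). Then $\mathrm{mad}(H')\leq \frac{18}{7}$, equivalently $\rho_{H'}(T)\geq 0$ for every $T\subseteq V(H')$.
   Context: For a graph $G$ and $A\subseteq V(G)$, $\rho_G(A)=9|A|-7|E(G[A])|$, where $G[A]$ is the induced subgraph, and $\rho^*_G(A)=\min\{\rho_G(S): A\subseteq S\subseteq V(G)\}$. Note $\mathrm{mad}(G)\leq 18/7$ iff $\rho_G(A)\geq 0$ for all $A\subseteq V(G)$. $\mathrm{mad}$ denotes the maximum average degree, the maximum of $2|E(F)|/|V(F)|$ over nonempty subgraphs $F$. -}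

module Defs where

open import Data.Nat using (ℕ; zero; suc; _+_; _*_; _≤_; _<ᵇ_; _≡ᵇ_)
open import Data.Integer using (ℤ; +_; _-_) renaming (_≤_ to _≤ℤ_)
open import Data.Bool using (Bool; true; false; _∧_; _∨_; if_then_else_)
open import Data.Fin using (Fin; toℕ; splitAt; _≟_)
open import Data.Fin.Subset using (Subset; _∈_; _⊆_; ∣_∣; Nonempty)
open import Data.Fin.Subset.Properties using (_∈?_)
open import Data.List using (List; map; allFin)
open import Data.Nat.ListAction using (sum)
open import Data.Sum using (_⊎_; inj₁; inj₂)
open import Data.Product using (_×_)
open import Relation.Nullary using (does)
open import Relation.Binary.PropositionalEquality using (_≡_)

-- A (loopless multi)graph on vertex set Fin n is given by an edge-multiplicity
-- function.  Only the values adj i j with toℕ i < toℕ j are used for counting.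
Adj : ℕ → Set
Adj n = Fin n → Fin n → ℕ

record SimpleGraph (n : ℕ) : Set where
  field
    adj      : Adj n
    sym      : ∀ i j → adj i j ≡ adj j i
    loopless : ∀ i → adj i i ≡ 0
    simple   : ∀ i j → adj i j ≤ 1
open SimpleGraph public

_∈ᵇ_ : ∀ {n} → Fin n → Subset n → Bool
i ∈ᵇ S = does (i ∈? S)

_==_ : ∀ {n} → Fin n → Fin n → Bool
i == j = does (i ≟ j)

eCount : ∀ {n} → Adj n → Subset n → ℕ
eCount {n} a A =
  sum (map (λ i → sum (map (λ j →
        if (i ∈ᵇ A) ∧ (j ∈ᵇ A) ∧ (toℕ i <ᵇ toℕ j) then a i j else 0)
      (allFin n))) (allFin n))

ρ : ∀ {n} → Adj n → Subset n → ℤ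
ρ a A = + (9 * ∣ A ∣) - + (7 * eCount a A)

-- ρ*_G(A) ≥ c, i.e. min{ρ_G(S) : A ⊆ S ⊆ V(G)} ≥ c
ρ*≥ : ∀ {n} → Adj n → Subset n → ℤ → Set
ρ*≥ a A c = ∀ S → A ⊆ S → c ≤ℤ ρ a S

-- mad(G) ≤ 18/7 : for every nonempty (induced) subgraph F,
-- 2|E(F)|/|V(F)| ≤ 18/7, i.e. 14|E(F)| ≤ 18|V(F)|.
madLe18/7 : ∀ {n} → Adj n → Set
madLe18/7 a = ∀ S → Nonempty S → 14 * eCount a S ≤ 18 * ∣ S ∣

pair : ∀ {n} → Fin n → Fin n → Subset n
pair u v = Data.Vec.tabulate (λ x → if (x == u) ∨ (x == v) then Data.Fin.Subset.inside else Data.Fin.Subset.outside)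
  where import Data.Vec
        import Data.Fin.Subset

b2n : Bool → ℕ
b2n true = 1
b2n false = 0

-- H' : vertices Fin (n + k); Fin n = old vertices (via inject+), the new
-- path vertices p₀ … p_{k-1} are raise n a for a : Fin k.
-- New path: u – p₀ – p₁ – … – p_{k-1} – v ; when k = 0 a new edge uv.
addPathAdj : ∀ {n} → Adj n → Fin n → Fin n → (k : ℕ) → Adj (n + k)
addPathAdj {n} a u v k x y = go (splitAt n x) (splitAt n y)
  where
  oldNew : Fin n → Fin k → ℕ
  oldNew i p = b2n ((i == u) ∧ (toℕ p ≡ᵇ 0)) + b2n ((i == v) ∧ (suc (toℕ p) ≡ᵇ k))
  go : Fin n ⊎ Fin k → Fin n ⊎ Fin k → ℕ
  go (inj₁ i) (inj₁ j) = a i j + b2n ((k ≡ᵇ 0) ∧ (((i == u) ∧ (j == v)) ∨ ((i == v) ∧ (j == u))))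
  go (inj₁ i) (inj₂ p) = oldNew i p
  go (inj₂ p) (inj₁ i) = oldNew i p
  go (inj₂ p) (inj₂ q) = b2n ((suc (toℕ p) ≡ᵇ toℕ q) ∨ (suc (toℕ q) ≡ᵇ toℕ p))

-- Let T ⊆ V(H′), T₀ = T ∩ V(H) and c the number of internal path vertices in T. The edges of
-- H′[T] are those of H[T₀] plus the path edges inside T, and the path has at most c edges inside T
-- unless T contains all of it, in which case it has k + 1 of them and c = k. In the first case
-- 7|E(H′[T])| ≤ 9|T| follows from ρ_H(T₀) ≥ 0; in the second T₀ ⊇ {u, v}, and ρ_H(T₀) ≥ 7 − 2k
-- pays exactly for the deficit 7(k + 1) − 9k of the path.

module Submission where

open import Defs hiding (sym)

open import Data.Bool using (Bool; true; false; _∧_; _∨_; if_then_else_)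
open import Data.Bool.Properties using (T-≡; ¬-not)
open import Data.Empty using (⊥-elim)
open import Data.Fin using (Fin; zero; suc; toℕ; _↑ˡ_; _↑ʳ_; _≟_)
open import Data.Fin.Properties using (splitAt-↑ˡ; splitAt-↑ʳ; toℕ-↑ˡ; toℕ-↑ʳ; toℕ<n)
open import Data.Fin.Subset using (Subset; Nonempty; ∣_∣; _∈_; _⊆_)
open import Data.Fin.Subset.Properties using (nonempty?)
open import Data.Integer using (ℤ; +_; _-_; +≤+) renaming (_≤_ to _≤ℤ_; _+_ to _+ℤ_)
import Data.Integer.Properties as ℤ
import Data.Integer.Tactic.RingSolver as ℤ
import Data.List as List using (map; tabulate)
open import Data.Nat using (ℕ; zero; suc; _+_; _*_; _≤_; _<_; _<ᵇ_; _≡ᵇ_; z≤n; s≤s)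
import Data.Nat.ListAction as List
open import Data.Nat.Properties hiding (_≟_)
open import Data.Nat.Tactic.RingSolver using (solve-∀)
open import Data.Product using (_×_; _,_)
open import Data.Sum using (_⊎_; inj₁; inj₂)
open import Data.Vec using ([]; _∷_; lookup; tabulate)
open import Data.Vec.Functional using (Vector)
open import Data.Vec.Properties using (lookup∘tabulate; []=⇒lookup; lookup⇒[]=)
open import Function using (_∘_; Equivalence)
open import Relation.Binary.PropositionalEquality
open import Relation.Nullary using (yes; no; ¬_)
open import Algebra.Properties.Semiring.Sum +-*-semiring
  using (sum; sum-syntax; ∑-distrib-+; sum-cong-≗; sum-replicate-zero; *-distribˡ-sum)

b2n-∧ : ∀ x y → b2n (x ∧ y) ≡ b2n x * b2n y
b2n-∧ true  y = sym (+-identityʳ (b2n y))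
b2n-∧ false y = refl

b2n-∨ : ∀ x y → b2n (x ∨ y) ≤ b2n x + b2n y
b2n-∨ true  y = s≤s z≤n
b2n-∨ false y = ≤-refl

b2n*≤ : ∀ x y → b2n x * y ≤ y
b2n*≤ true  y = ≤-reflexive (+-identityʳ y)
b2n*≤ false y = z≤n

if-then-0 : ∀ b x → (if b then x else 0) ≡ b2n b * x
if-then-0 true  x = sym (+-identityʳ x)
if-then-0 false x = refl

<ᵇ-true : ∀ {m n} → m < n → (m <ᵇ n) ≡ true
<ᵇ-true m<n = Equivalence.to T-≡ (<⇒<ᵇ m<n)

<ᵇ-false : ∀ {m n} → n ≤ m → (m <ᵇ n) ≡ false
<ᵇ-false {m} {n} n≤m = ¬-not λ m<ᵇn → <⇒≱ (<ᵇ⇒< m n (Equivalence.from T-≡ m<ᵇn)) n≤m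

+-cancelˡ-<ᵇ : ∀ n x y → (n + x <ᵇ n + y) ≡ (x <ᵇ y)
+-cancelˡ-<ᵇ zero    x y = refl
+-cancelˡ-<ᵇ (suc n) x y = +-cancelˡ-<ᵇ n x y

<ᵇ-asym : ∀ x y → b2n (x <ᵇ y) + b2n (y <ᵇ x) ≤ 1
<ᵇ-asym zero    zero    = z≤n
<ᵇ-asym zero    (suc y) = s≤s z≤n
<ᵇ-asym (suc x) zero    = s≤s z≤n
<ᵇ-asym (suc x) (suc y) = <ᵇ-asym x y

<ᵇ*consecutive≤ : ∀ x y → b2n (x <ᵇ y) * b2n ((suc x ≡ᵇ y) ∨ (suc y ≡ᵇ x)) ≤ b2n (suc x ≡ᵇ y)
<ᵇ*consecutive≤ zero    zero          = z≤n
<ᵇ*consecutive≤ zero    (suc zero)    = s≤s z≤n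
<ᵇ*consecutive≤ zero    (suc (suc y)) = z≤n
<ᵇ*consecutive≤ (suc x) zero          = z≤n
<ᵇ*consecutive≤ (suc x) (suc y)       = <ᵇ*consecutive≤ x y

∑-mono-≤ : ∀ {n} {f g : Vector ℕ n} → (∀ i → f i ≤ g i) → sum f ≤ sum g
∑-mono-≤ {zero}  f≤g = z≤n
∑-mono-≤ {suc n} f≤g = +-mono-≤ (f≤g zero) (∑-mono-≤ (f≤g ∘ suc))

∑-zero : ∀ {n} {f : Vector ℕ n} → (∀ i → f i ≡ 0) → sum f ≡ 0
∑-zero {n} f≡0 = trans (sum-cong-≗ f≡0) (sum-replicate-zero n)

∑-↑ : ∀ n {k} (f : Vector ℕ (n + k)) → sum f ≡ ∑[ i < n ] f (i ↑ˡ k) + ∑[ p < k ] f (n ↑ʳ p)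
∑-↑ zero    f = refl
∑-↑ (suc n) f = trans (cong (_+_ (f zero)) (∑-↑ n (f ∘ suc))) (sym (+-assoc (f zero) _ _))

∑-δ : ∀ {n} (u : Fin n) (f : Vector ℕ n) → ∑[ i < n ] (b2n (i == u) * f i) ≡ f u
∑-δ {suc n} zero    f = trans (cong₂ _+_ (+-identityʳ (f zero)) (∑-zero {n} {λ _ → 0} λ _ → refl)) (+-identityʳ (f zero))
∑-δ {suc n} (suc u) f = ∑-δ u (f ∘ suc)

∑∑-δ : ∀ {n k} (u : Fin n) (g : Fin n → Fin k → ℕ) →
  ∑[ i < n ] ∑[ p < k ] (b2n (i == u) * g i p) ≡ ∑[ p < k ] g u p
∑∑-δ {n} {k} u g = begin
  ∑[ i < n ] ∑[ p < k ] (b2n (i == u) * g i p)  ≡⟨ sum-cong-≗ (λ i → *-distribˡ-sum (b2n (i == u)) (g i)) ⟨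
  ∑[ i < n ] (b2n (i == u) * ∑[ p < k ] g i p)  ≡⟨ ∑-δ u _ ⟩
  ∑[ p < k ] g u p                              ∎
  where open ≡-Reasoning

∑∑-distrib-+ : ∀ {n k} (f g : Fin n → Fin k → ℕ) →
  ∑[ i < n ] ∑[ p < k ] (f i p + g i p) ≡ ∑[ i < n ] ∑[ p < k ] f i p + ∑[ i < n ] ∑[ p < k ] g i p
∑∑-distrib-+ {k = k} f g =
  trans (sum-cong-≗ λ i → ∑-distrib-+ (f i) (g i)) (∑-distrib-+ (λ i → ∑[ p < k ] f i p) (λ i → ∑[ p < k ] g i p))

∑∑-↑ : ∀ n {k} (f : Fin (n + k) → Fin (n + k) → ℕ) →
  ∑[ x < n + k ] ∑[ y < n + k ] f x y
  ≡ (∑[ i < n ] ∑[ j < n ] f (i ↑ˡ k) (j ↑ˡ k) + ∑[ i < n ] ∑[ p < k ] f (i ↑ˡ k) (n ↑ʳ p))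
  + (∑[ p < k ] ∑[ j < n ] f (n ↑ʳ p) (j ↑ˡ k) + ∑[ p < k ] ∑[ q < k ] f (n ↑ʳ p) (n ↑ʳ q))
∑∑-↑ n {k} f = begin
  ∑[ x < n + k ] ∑[ y < n + k ] f x y
    ≡⟨ ∑-↑ n _ ⟩
  ∑[ i < n ] ∑[ y < n + k ] f (i ↑ˡ k) y + ∑[ p < k ] ∑[ y < n + k ] f (n ↑ʳ p) y
    ≡⟨ cong₂ _+_ (trans (sum-cong-≗ λ i → ∑-↑ n (f (i ↑ˡ k)))
                        (∑-distrib-+ (λ i → ∑[ j < n ] f (i ↑ˡ k) (j ↑ˡ k)) (λ i → ∑[ p < k ] f (i ↑ˡ k) (n ↑ʳ p))))
                 (trans (sum-cong-≗ λ p → ∑-↑ n (f (n ↑ʳ p)))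
                        (∑-distrib-+ (λ p → ∑[ j < n ] f (n ↑ʳ p) (j ↑ˡ k)) (λ p → ∑[ q < k ] f (n ↑ʳ p) (n ↑ʳ q)))) ⟩
  _ ∎
  where open ≡-Reasoning

sum-map-tabulate : ∀ {n} {B : Set} (g : B → ℕ) (h : Fin n → B) →
  List.sum (List.map g (List.tabulate h)) ≡ ∑[ i < n ] g (h i)
sum-map-tabulate {zero}  g h = refl
sum-map-tabulate {suc n} g h = cong (_+_ (g (h zero))) (sum-map-tabulate g (h ∘ suc))

∈ᵇ≡lookup : ∀ {n} (i : Fin n) (p : Subset n) → (i ∈ᵇ p) ≡ lookup p i
∈ᵇ≡lookup zero    (true  ∷ p) = refl
∈ᵇ≡lookup zero    (false ∷ p) = refl
∈ᵇ≡lookup (suc i) (_ ∷ p)     = ∈ᵇ≡lookup i p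

∣p∣≡∑ : ∀ {n} (p : Subset n) → ∣ p ∣ ≡ ∑[ i < n ] b2n (lookup p i)
∣p∣≡∑ []          = refl
∣p∣≡∑ (true  ∷ p) = cong suc (∣p∣≡∑ p)
∣p∣≡∑ (false ∷ p) = ∣p∣≡∑ p

inducedAdj : ∀ {n} → Adj n → (Fin n → Bool) → Fin n → Fin n → ℕ
inducedAdj a m i j = b2n (m i) * (b2n (m j) * (b2n (toℕ i <ᵇ toℕ j) * a i j))

eCount≡∑ : ∀ {n} (a : Adj n) (A : Subset n) →
  eCount a A ≡ ∑[ i < n ] ∑[ j < n ] inducedAdj a (lookup A) i j
eCount≡∑ {n} a A =
  trans (sum-map-tabulate {n} _ (λ i → i))
        (sum-cong-≗ λ i → trans (sum-map-tabulate {n} _ (λ j → j)) (sum-cong-≗ λ j → summand i j))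
  where
  summand : ∀ i j → (if (i ∈ᵇ A) ∧ (j ∈ᵇ A) ∧ (toℕ i <ᵇ toℕ j) then a i j else 0)
                  ≡ inducedAdj a (lookup A) i j
  summand i j rewrite ∈ᵇ≡lookup i A | ∈ᵇ≡lookup j A
                    | if-then-0 (lookup A i ∧ lookup A j ∧ (toℕ i <ᵇ toℕ j)) (a i j)
                    | b2n-∧ (lookup A i) (lookup A j ∧ (toℕ i <ᵇ toℕ j))
                    | b2n-∧ (lookup A j) (toℕ i <ᵇ toℕ j) =
    trans (*-assoc (b2n (lookup A i)) _ _) (cong (b2n (lookup A i) *_) (*-assoc (b2n (lookup A j)) _ _))

eCount-empty : ∀ {n} (a : Adj n) (A : Subset n) → ¬ Nonempty A → eCount a A ≡ 0
eCount-empty a A A-empty =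
  trans (eCount≡∑ a A) (∑-zero λ i → ∑-zero λ j →
    cong (λ b → b2n b * (b2n (lookup A j) * (b2n (toℕ i <ᵇ toℕ j) * a i j))) (outside i))
  where
  outside : ∀ i → lookup A i ≡ false
  outside i with lookup A i in eq
  ... | true  = ⊥-elim (A-empty (i , lookup⇒[]= i A eq))
  ... | false = refl

pair-⊆ : ∀ {n} {u v : Fin n} {A : Subset n} → u ∈ A → v ∈ A → pair u v ⊆ A
pair-⊆ {u = u} {v} u∈A v∈A {x} x∈pair
  with x ≟ u | x ≟ v | trans (sym (lookup∘tabulate _ x)) ([]=⇒lookup x∈pair)
... | yes refl | _        | _  = u∈A
... | no _     | yes refl | _  = v∈A
... | no _     | no _     | ()

-- For the path u – p₀ – … – p_{k-1} – v, m p records whether p_p lies in the vertex set and bu, bv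
-- whether u and v do; pathEdges counts the path edges with both ends in the set, its first summand
-- being the edge uv of the case k = 0.
uEdge : (k : ℕ) → (Fin k → Bool) → Bool → ℕ
uEdge k m bu = ∑[ p < k ] (b2n bu * b2n (m p) * b2n (toℕ p ≡ᵇ 0))

vEdge : (k : ℕ) → (Fin k → Bool) → Bool → ℕ
vEdge k m bv = ∑[ p < k ] (b2n bv * b2n (m p) * b2n (suc (toℕ p) ≡ᵇ k))

innerEdges : (k : ℕ) → (Fin k → Bool) → ℕ
innerEdges k m = ∑[ p < k ] ∑[ q < k ] (b2n (m p) * b2n (m q) * b2n (suc (toℕ p) ≡ᵇ toℕ q))

pathEdges : (k : ℕ) → (Fin k → Bool) → Bool → Bool → ℕ
pathEdges k m bu bv = b2n (k ≡ᵇ 0) * (b2n bu * b2n bv) + (uEdge k m bu + vEdge k m bv) + innerEdges k m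

uEdge-suc : ∀ k m bu → uEdge (suc k) m bu ≡ b2n bu * b2n (m zero)
uEdge-suc k m bu = trans
  (cong₂ _+_ (*-identityʳ (b2n bu * b2n (m zero))) (∑-zero λ p → *-zeroʳ (b2n bu * b2n (m (suc p)))))
  (+-identityʳ _)

vEdge-suc : ∀ k m bv → vEdge (suc k) m bv ≡ b2n bv * b2n (m zero) * b2n (k ≡ᵇ 0) + vEdge k (m ∘ suc) bv
vEdge-suc zero    m bv = refl
vEdge-suc (suc k) m bv = refl

innerEdges-suc : ∀ k m → innerEdges (suc k) m ≡ uEdge k (m ∘ suc) (m zero) + innerEdges k (m ∘ suc)
innerEdges-suc k m = cong₂ _+_ firstRow (sum-cong-≗ {k} otherRow)
  where
  m₀ = b2n (m zero)
  firstRow : m₀ * m₀ * 0 + ∑[ q < k ] (m₀ * b2n (m (suc q)) * b2n (0 ≡ᵇ toℕ q)) ≡ uEdge k (m ∘ suc) (m zero)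
  firstRow = cong₂ _+_ (*-zeroʳ (m₀ * m₀)) (sum-cong-≗ {k} λ { zero → refl ; (suc q) → refl })
  row : Fin k → ℕ
  row p = ∑[ q < k ] (b2n (m (suc p)) * b2n (m (suc q)) * b2n (suc (toℕ p) ≡ᵇ toℕ q))
  otherRow : ∀ p → b2n (m (suc p)) * m₀ * 0 + row p ≡ row p
  otherRow p = cong (_+ row p) (*-zeroʳ (b2n (m (suc p)) * m₀))

pathEdges-suc : ∀ k m bu bv →
  pathEdges (suc k) m bu bv ≡ b2n bu * b2n (m zero) + pathEdges k (m ∘ suc) (m zero) bv
pathEdges-suc k m bu bv
  rewrite uEdge-suc k m bu | vEdge-suc k m bv | innerEdges-suc k m =
  rearrange (b2n bu) (b2n (m zero)) (b2n bv) (b2n (k ≡ᵇ 0))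
            (vEdge k (m ∘ suc) bv) (uEdge k (m ∘ suc) (m zero)) (innerEdges k (m ∘ suc))
  where
  rearrange : ∀ x y z K V U I → (x * y + (z * y * K + V)) + (U + I) ≡ x * y + (K * (y * z) + (U + V) + I)
  rearrange = solve-∀

count : (k : ℕ) → (Fin k → Bool) → ℕ
count k m = ∑[ p < k ] b2n (m p)

pathEdges-bound : ∀ k m bu bv →
  pathEdges k m bu bv ≤ count k m
  ⊎ (bu ≡ true × bv ≡ true × pathEdges k m bu bv ≤ suc k × k ≤ count k m)
pathEdges-bound zero m true  true  = inj₂ (refl , refl , ≤-refl , z≤n)
pathEdges-bound zero m true  false = inj₁ z≤n
pathEdges-bound zero m false bv    = inj₁ z≤n
pathEdges-bound (suc k) m bu bv rewrite pathEdges-suc k m bu bv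
  with pathEdges-bound k (m ∘ suc) (m zero) bv
... | inj₁ P≤c = inj₁ (+-mono-≤ (b2n*≤ bu (b2n (m zero))) P≤c)
... | inj₂ (m₀ , bv≡true , P≤1+k , k≤c) with bu
...   | true  rewrite m₀ = inj₂ (refl , bv≡true , s≤s P≤1+k , s≤s k≤c)
...   | false rewrite m₀ = inj₁ (≤-trans P≤1+k (s≤s k≤c))

module AddPath {n : ℕ} (a : Adj n) (u v : Fin n) (k : ℕ) (T : Subset (n + k)) where

  H′ : Adj (n + k)
  H′ = addPathAdj a u v k

  old : Fin n → Bool
  old i = lookup T (i ↑ˡ k)

  new : Fin k → Bool
  new p = lookup T (n ↑ʳ p)

  oldPart : Subset n
  oldPart = tabulate old

  H′-old-old : ∀ i j → H′ (i ↑ˡ k) (j ↑ˡ k) ≡ a i j + b2n ((k ≡ᵇ 0) ∧ (((i == u) ∧ (j == v)) ∨ ((i == v) ∧ (j == u))))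
  H′-old-old i j rewrite splitAt-↑ˡ n i k | splitAt-↑ˡ n j k = refl

  H′-old-new : ∀ i p → H′ (i ↑ˡ k) (n ↑ʳ p) ≡ b2n ((i == u) ∧ (toℕ p ≡ᵇ 0)) + b2n ((i == v) ∧ (suc (toℕ p) ≡ᵇ k))
  H′-old-new i p rewrite splitAt-↑ˡ n i k | splitAt-↑ʳ n k p = refl

  H′-new-new : ∀ p q → H′ (n ↑ʳ p) (n ↑ʳ q) ≡ b2n ((suc (toℕ p) ≡ᵇ toℕ q) ∨ (suc (toℕ q) ≡ᵇ toℕ p))
  H′-new-new p q rewrite splitAt-↑ʳ n k p | splitAt-↑ʳ n k q = refl

  old<new : ∀ (i : Fin n) (p : Fin k) → toℕ (i ↑ˡ k) < toℕ (n ↑ʳ p)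
  old<new i p rewrite toℕ-↑ˡ i k | toℕ-↑ʳ n p = ≤-trans (toℕ<n i) (m≤m+n n (toℕ p))

  H′[T] : Fin (n + k) → Fin (n + k) → ℕ
  H′[T] = inducedAdj H′ (lookup T)

  directEdge : Fin n → Fin n → ℕ
  directEdge i j = b2n (k ≡ᵇ 0) * (b2n (old i) * (b2n (old j) * b2n (toℕ i <ᵇ toℕ j)))

  old-old-≤ : ∀ i j → H′[T] (i ↑ˡ k) (j ↑ˡ k)
    ≤ inducedAdj a old i j + (b2n (i == u) * (b2n (j == v) * directEdge i j) + b2n (i == v) * (b2n (j == u) * directEdge i j))
  old-old-≤ i j = begin
    H′[T] (i ↑ˡ k) (j ↑ˡ k)
      ≡⟨ cong₂ (λ l e → b2n (old i) * (b2n (old j) * (b2n l * e)))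
               (cong₂ _<ᵇ_ (toℕ-↑ˡ i k) (toℕ-↑ˡ j k)) (H′-old-old i j) ⟩
    oi * (oj * (lt * (a i j + b2n (K ∧ ((δu ∧ δv′) ∨ (δv ∧ δu′))))))
      ≤⟨ *-monoʳ-≤ oi (*-monoʳ-≤ oj (*-monoʳ-≤ lt (+-monoʳ-≤ (a i j) new-edge≤))) ⟩
    oi * (oj * (lt * (a i j + b2n K * (b2n δu * b2n δv′ + b2n δv * b2n δu′))))
      ≡⟨ rearrange oi oj lt (a i j) (b2n K) (b2n δu) (b2n δv′) (b2n δv) (b2n δu′) ⟩
    inducedAdj a old i j + (b2n δu * (b2n δv′ * directEdge i j) + b2n δv * (b2n δu′ * directEdge i j)) ∎
    where
    open ≤-Reasoning
    oi = b2n (old i)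
    oj = b2n (old j)
    lt = b2n (toℕ i <ᵇ toℕ j)
    K = k ≡ᵇ 0
    δu = i == u
    δv = i == v
    δu′ = j == u
    δv′ = j == v
    new-edge≤ : b2n (K ∧ ((δu ∧ δv′) ∨ (δv ∧ δu′))) ≤ b2n K * (b2n δu * b2n δv′ + b2n δv * b2n δu′)
    new-edge≤ = begin
      b2n (K ∧ ((δu ∧ δv′) ∨ (δv ∧ δu′)))           ≡⟨ b2n-∧ K _ ⟩
      b2n K * b2n ((δu ∧ δv′) ∨ (δv ∧ δu′))         ≤⟨ *-monoʳ-≤ (b2n K) (b2n-∨ (δu ∧ δv′) (δv ∧ δu′)) ⟩
      b2n K * (b2n (δu ∧ δv′) + b2n (δv ∧ δu′))     ≡⟨ cong (b2n K *_) (cong₂ _+_ (b2n-∧ δu δv′) (b2n-∧ δv δu′)) ⟩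
      b2n K * (b2n δu * b2n δv′ + b2n δv * b2n δu′) ∎
    rearrange : ∀ x y l e c p q r s →
      x * (y * (l * (e + c * (p * q + r * s))))
      ≡ x * (y * (l * e)) + (p * (q * (c * (x * (y * l)))) + r * (s * (c * (x * (y * l)))))
    rearrange = solve-∀

  eCount-oldPart : eCount a oldPart ≡ ∑[ i < n ] ∑[ j < n ] inducedAdj a old i j
  eCount-oldPart = trans (eCount≡∑ a oldPart) (sum-cong-≗ λ i → sum-cong-≗ λ j →
    cong₂ (λ x y → b2n x * (b2n y * (b2n (toℕ i <ᵇ toℕ j) * a i j)))
          (lookup∘tabulate old i) (lookup∘tabulate old j))

  directEdge-≤ : directEdge u v + directEdge v u ≤ b2n (k ≡ᵇ 0) * (b2n (old u) * b2n (old v))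
  directEdge-≤ = begin
    directEdge u v + directEdge v u
      ≡⟨ factor (b2n (k ≡ᵇ 0)) (b2n (old u)) (b2n (old v)) (b2n (toℕ u <ᵇ toℕ v)) (b2n (toℕ v <ᵇ toℕ u)) ⟩
    b2n (k ≡ᵇ 0) * (b2n (old u) * b2n (old v)) * (b2n (toℕ u <ᵇ toℕ v) + b2n (toℕ v <ᵇ toℕ u))
      ≤⟨ *-monoʳ-≤ (b2n (k ≡ᵇ 0) * (b2n (old u) * b2n (old v))) (<ᵇ-asym (toℕ u) (toℕ v)) ⟩
    b2n (k ≡ᵇ 0) * (b2n (old u) * b2n (old v)) * 1
      ≡⟨ *-identityʳ _ ⟩
    b2n (k ≡ᵇ 0) * (b2n (old u) * b2n (old v)) ∎
    where
    open ≤-Reasoning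
    factor : ∀ c x y l l′ → c * (x * (y * l)) + c * (y * (x * l′)) ≡ c * (x * y) * (l + l′)
    factor = solve-∀

  old-old-sum : ∑[ i < n ] ∑[ j < n ] H′[T] (i ↑ˡ k) (j ↑ˡ k)
    ≤ eCount a oldPart + b2n (k ≡ᵇ 0) * (b2n (old u) * b2n (old v))
  old-old-sum = begin
    ∑[ i < n ] ∑[ j < n ] H′[T] (i ↑ˡ k) (j ↑ˡ k)
      ≤⟨ ∑-mono-≤ (λ i → ∑-mono-≤ (old-old-≤ i)) ⟩
    ∑[ i < n ] ∑[ j < n ] (inducedAdj a old i j + (δuv i j + δvu i j))
      ≡⟨ ∑∑-distrib-+ (inducedAdj a old) (λ i j → δuv i j + δvu i j) ⟩
    ∑[ i < n ] ∑[ j < n ] inducedAdj a old i j + ∑[ i < n ] ∑[ j < n ] (δuv i j + δvu i j)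
      ≡⟨ cong₂ _+_ (sym eCount-oldPart) (trans (∑∑-distrib-+ δuv δvu) (cong₂ _+_
           (trans (∑∑-δ u λ i j → b2n (j == v) * directEdge i j) (∑-δ v (directEdge u)))
           (trans (∑∑-δ v λ i j → b2n (j == u) * directEdge i j) (∑-δ u (directEdge v))))) ⟩
    eCount a oldPart + (directEdge u v + directEdge v u)
      ≤⟨ +-monoʳ-≤ (eCount a oldPart) directEdge-≤ ⟩
    eCount a oldPart + b2n (k ≡ᵇ 0) * (b2n (old u) * b2n (old v)) ∎
    where
    open ≤-Reasoning
    δuv δvu : Fin n → Fin n → ℕ
    δuv i j = b2n (i == u) * (b2n (j == v) * directEdge i j)
    δvu i j = b2n (i == v) * (b2n (j == u) * directEdge i j)

  old-new-sum : ∑[ i < n ] ∑[ p < k ] H′[T] (i ↑ˡ k) (n ↑ʳ p) ≡ uEdge k new (old u) + vEdge k new (old v)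
  old-new-sum = begin
    ∑[ i < n ] ∑[ p < k ] H′[T] (i ↑ˡ k) (n ↑ʳ p)
      ≡⟨ sum-cong-≗ (λ i → sum-cong-≗ (old-new i)) ⟩
    ∑[ i < n ] ∑[ p < k ] (b2n (i == u) * toU i p + b2n (i == v) * toV i p)
      ≡⟨ ∑∑-distrib-+ (λ i p → b2n (i == u) * toU i p) (λ i p → b2n (i == v) * toV i p) ⟩
    ∑[ i < n ] ∑[ p < k ] (b2n (i == u) * toU i p) + ∑[ i < n ] ∑[ p < k ] (b2n (i == v) * toV i p)
      ≡⟨ cong₂ _+_ (∑∑-δ u toU) (∑∑-δ v toV) ⟩
    uEdge k new (old u) + vEdge k new (old v) ∎
    where
    open ≡-Reasoning
    toU toV : Fin n → Fin k → ℕ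
    toU i p = b2n (old i) * b2n (new p) * b2n (toℕ p ≡ᵇ 0)
    toV i p = b2n (old i) * b2n (new p) * b2n (suc (toℕ p) ≡ᵇ k)
    old-new : ∀ i p → H′[T] (i ↑ˡ k) (n ↑ʳ p) ≡ b2n (i == u) * toU i p + b2n (i == v) * toV i p
    old-new i p = begin
      H′[T] (i ↑ˡ k) (n ↑ʳ p)
        ≡⟨ cong₂ (λ l e → b2n (old i) * (b2n (new p) * (b2n l * e))) (<ᵇ-true (old<new i p)) (H′-old-new i p) ⟩
      b2n (old i) * (b2n (new p) * (1 * (b2n ((i == u) ∧ z) + b2n ((i == v) ∧ z′))))
        ≡⟨ cong (λ e → b2n (old i) * (b2n (new p) * (1 * e))) (cong₂ _+_ (b2n-∧ (i == u) z) (b2n-∧ (i == v) z′)) ⟩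
      b2n (old i) * (b2n (new p) * (1 * (b2n (i == u) * b2n z + b2n (i == v) * b2n z′)))
        ≡⟨ rearrange (b2n (old i)) (b2n (new p)) (b2n (i == u)) (b2n z) (b2n (i == v)) (b2n z′) ⟩
      b2n (i == u) * toU i p + b2n (i == v) * toV i p ∎
      where
      z = toℕ p ≡ᵇ 0
      z′ = suc (toℕ p) ≡ᵇ k
      rearrange : ∀ x y d e d′ e′ → x * (y * (1 * (d * e + d′ * e′))) ≡ d * (x * y * e) + d′ * (x * y * e′)
      rearrange = solve-∀

  new-old-sum : ∑[ p < k ] ∑[ j < n ] H′[T] (n ↑ʳ p) (j ↑ˡ k) ≡ 0
  new-old-sum = ∑-zero λ p → ∑-zero λ j →
    trans (cong (λ l → b2n (new p) * (b2n (old j) * (b2n l * H′ (n ↑ʳ p) (j ↑ˡ k))))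
                (<ᵇ-false (<⇒≤ (old<new j p))))
          (trans (cong (b2n (new p) *_) (*-zeroʳ (b2n (old j)))) (*-zeroʳ (b2n (new p))))

  new-new-sum : ∑[ p < k ] ∑[ q < k ] H′[T] (n ↑ʳ p) (n ↑ʳ q) ≤ innerEdges k new
  new-new-sum = ∑-mono-≤ λ p → ∑-mono-≤ λ q → begin
    H′[T] (n ↑ʳ p) (n ↑ʳ q)
      ≡⟨ cong₂ (λ l e → b2n (new p) * (b2n (new q) * (b2n l * e)))
               (trans (cong₂ _<ᵇ_ (toℕ-↑ʳ n p) (toℕ-↑ʳ n q)) (+-cancelˡ-<ᵇ n (toℕ p) (toℕ q)))
               (H′-new-new p q) ⟩
    b2n (new p) * (b2n (new q) * (b2n (toℕ p <ᵇ toℕ q) * b2n ((suc (toℕ p) ≡ᵇ toℕ q) ∨ (suc (toℕ q) ≡ᵇ toℕ p))))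
      ≤⟨ *-monoʳ-≤ (b2n (new p)) (*-monoʳ-≤ (b2n (new q)) (<ᵇ*consecutive≤ (toℕ p) (toℕ q))) ⟩
    b2n (new p) * (b2n (new q) * b2n (suc (toℕ p) ≡ᵇ toℕ q))
      ≡⟨ *-assoc (b2n (new p)) _ _ ⟨
    b2n (new p) * b2n (new q) * b2n (suc (toℕ p) ≡ᵇ toℕ q) ∎
    where open ≤-Reasoning

  eCount-addPath≤ : eCount H′ T ≤ eCount a oldPart + pathEdges k new (old u) (old v)
  eCount-addPath≤ = begin
    eCount H′ T
      ≡⟨ trans (eCount≡∑ H′ T) (∑∑-↑ n H′[T]) ⟩
    (∑[ i < n ] ∑[ j < n ] H′[T] (i ↑ˡ k) (j ↑ˡ k) + ∑[ i < n ] ∑[ p < k ] H′[T] (i ↑ˡ k) (n ↑ʳ p))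
      + (∑[ p < k ] ∑[ j < n ] H′[T] (n ↑ʳ p) (j ↑ˡ k) + ∑[ p < k ] ∑[ q < k ] H′[T] (n ↑ʳ p) (n ↑ʳ q))
      ≤⟨ +-mono-≤ (+-mono-≤ old-old-sum (≤-reflexive old-new-sum)) (+-mono-≤ (≤-reflexive new-old-sum) new-new-sum) ⟩
    (eCount a oldPart + b2n (k ≡ᵇ 0) * (b2n (old u) * b2n (old v)) + (uEdge k new (old u) + vEdge k new (old v)))
      + (0 + innerEdges k new)
      ≡⟨ regroup (eCount a oldPart) _ _ _ ⟩
    eCount a oldPart + pathEdges k new (old u) (old v) ∎
    where
    open ≤-Reasoning
    regroup : ∀ e x y z → e + x + y + (0 + z) ≡ e + (x + y + z)
    regroup = solve-∀

  ∣T∣≡ : ∣ T ∣ ≡ ∣ oldPart ∣ + count k new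
  ∣T∣≡ = begin
    ∣ T ∣                                               ≡⟨ ∣p∣≡∑ T ⟩
    ∑[ x < n + k ] b2n (lookup T x)                     ≡⟨ ∑-↑ n _ ⟩
    ∑[ i < n ] b2n (old i) + count k new                ≡⟨ cong (_+ count k new) (sum-cong-≗ λ i → cong b2n (lookup∘tabulate old i)) ⟨
    ∑[ i < n ] b2n (lookup oldPart i) + count k new     ≡⟨ cong (_+ count k new) (∣p∣≡∑ oldPart) ⟨
    ∣ oldPart ∣ + count k new                           ∎
    where open ≡-Reasoning

Sparse : ∀ {n} → Adj n → Set
Sparse a = ∀ A → 7 * eCount a A ≤ 9 * ∣ A ∣

madLe⇒Sparse : ∀ {n} (a : Adj n) → madLe18/7 a → Sparse a
madLe⇒Sparse a mad A with nonempty? A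
... | yes A≢∅ = *-cancelˡ-≤ 2 (subst₂ _≤_ (*-assoc 2 7 (eCount a A)) (*-assoc 2 9 ∣ A ∣) (mad A A≢∅))
... | no  A≡∅ rewrite eCount-empty a A A≡∅ = z≤n

Sparse⇒madLe : ∀ {n} (a : Adj n) → Sparse a → madLe18/7 a
Sparse⇒madLe a sparse A _ =
  subst₂ _≤_ (sym (*-assoc 2 7 (eCount a A))) (sym (*-assoc 2 9 ∣ A ∣)) (*-monoʳ-≤ 2 (sparse A))

Sparse⇒ρ≥0 : ∀ {n} (a : Adj n) → Sparse a → ∀ A → + 0 ≤ℤ ρ a A
Sparse⇒ρ≥0 a sparse A = ℤ.i≤j⇒0≤j-i (+≤+ (sparse A))

-≤-⇒+≤+ : ∀ m n p q → + m - + n ≤ℤ + p - + q → m + q ≤ p + n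
-≤-⇒+≤+ m n p q h = ℤ.drop‿+≤+ (ℤ.0≤i-j⇒j≤i (subst (+ 0 ≤ℤ_) regroup (ℤ.i≤j⇒0≤j-i h)))
  where
  shuffle : ∀ (P Q M N : ℤ) → (P - Q) - (M - N) ≡ (P +ℤ N) - (M +ℤ Q)
  shuffle = ℤ.solve-∀
  regroup : (+ p - + q) - (+ m - + n) ≡ + (p + n) - + (m + q)
  regroup = trans (shuffle (+ p) (+ q) (+ m) (+ n)) (sym (cong₂ _-_ (ℤ.pos-+ p n) (ℤ.pos-+ m q)))

ρ*≥-bound : ∀ {n} (a : Adj n) {B : Subset n} (A : Subset n) k →
  ρ*≥ a B (+ 7 - + (2 * k)) → B ⊆ A → 7 + 7 * eCount a A ≤ 9 * ∣ A ∣ + 2 * k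
ρ*≥-bound a A k ρ*≥7-2k B⊆A = -≤-⇒+≤+ 7 (2 * k) (9 * ∣ A ∣) (7 * eCount a A) (ρ*≥7-2k A B⊆A)

sparse-+ : ∀ e s {p c} → 7 * e ≤ 9 * s → p ≤ c → 7 * (e + p) ≤ 9 * (s + c)
sparse-+ e s {p} {c} 7e≤9s p≤c = begin
  7 * (e + p)    ≡⟨ *-distribˡ-+ 7 e p ⟩
  7 * e + 7 * p  ≤⟨ +-mono-≤ 7e≤9s (≤-trans (*-monoʳ-≤ 7 p≤c) (*-monoˡ-≤ c (m≤m+n 7 2))) ⟩
  9 * s + 9 * c  ≡⟨ *-distribˡ-+ 9 s c ⟨
  9 * (s + c)    ∎
  where open ≤-Reasoning

sparse-+-ear : ∀ e s {p c} k → 7 + 7 * e ≤ 9 * s + 2 * k → p ≤ suc k → k ≤ c → 7 * (e + p) ≤ 9 * (s + c)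
sparse-+-ear e s {p} {c} k ρ≥7-2k p≤1+k k≤c = begin
  7 * (e + p)              ≤⟨ *-monoʳ-≤ 7 (+-monoʳ-≤ e p≤1+k) ⟩
  7 * (e + suc k)          ≡⟨ expand e k ⟩
  (7 + 7 * e) + 7 * k      ≤⟨ +-monoˡ-≤ (7 * k) ρ≥7-2k ⟩
  (9 * s + 2 * k) + 7 * k  ≡⟨ collect s k ⟩
  9 * (s + k)              ≤⟨ *-monoʳ-≤ 9 (+-monoʳ-≤ s k≤c) ⟩
  9 * (s + c)              ∎
  where
  open ≤-Reasoning
  expand : ∀ e k → 7 * (e + suc k) ≡ (7 + 7 * e) + 7 * k
  expand = solve-∀
  collect : ∀ s k → (9 * s + 2 * k) + 7 * k ≡ 9 * (s + k)
  collect = solve-∀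

addPath-Sparse : ∀ {n} (a : Adj n) (u v : Fin n) (k : ℕ) →
  Sparse a → ρ*≥ a (pair u v) (+ 7 - + (2 * k)) → Sparse (addPathAdj a u v k)
addPath-Sparse a u v k sparse ρ*≥7-2k T = begin
  7 * eCount (addPathAdj a u v k) T                                ≤⟨ *-monoʳ-≤ 7 eCount-addPath≤ ⟩
  7 * (eCount a oldPart + pathEdges k new (old u) (old v))         ≤⟨ bound (pathEdges-bound k new (old u) (old v)) ⟩
  9 * (∣ oldPart ∣ + count k new)                                  ≡⟨ cong (9 *_) ∣T∣≡ ⟨
  9 * ∣ T ∣                                                        ∎
  where
  open AddPath a u v k T
  open ≤-Reasoning
  ∈oldPart : ∀ {x} → old x ≡ true → x ∈ oldPart
  ∈oldPart {x} eq = lookup⇒[]= x oldPart (trans (lookup∘tabulate old x) eq)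
  bound : pathEdges k new (old u) (old v) ≤ count k new
        ⊎ (old u ≡ true × old v ≡ true × pathEdges k new (old u) (old v) ≤ suc k × k ≤ count k new)
        → 7 * (eCount a oldPart + pathEdges k new (old u) (old v)) ≤ 9 * (∣ oldPart ∣ + count k new)
  bound (inj₁ P≤c) = sparse-+ (eCount a oldPart) ∣ oldPart ∣ (sparse oldPart) P≤c
  bound (inj₂ (u∈ , v∈ , P≤1+k , k≤c)) =
    sparse-+-ear (eCount a oldPart) ∣ oldPart ∣ k
      (ρ*≥-bound a oldPart k ρ*≥7-2k (pair-⊆ (∈oldPart u∈) (∈oldPart v∈))) P≤1+k k≤c

lemma1 : ∀ {n} (H : SimpleGraph n) (k : ℕ) (u v : Fin n) → u ≢ v →
    madLe18/7 (adj H) →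
    ρ*≥ (adj H) (pair u v) (+ 7 - + (2 * k)) →
    madLe18/7 (addPathAdj (adj H) u v k) ×
      (∀ (T : Subset (n + k)) → + 0 ≤ℤ ρ (addPathAdj (adj H) u v k) T)
lemma1 {n} H k u v _ mad ρ*≥7-2k = Sparse⇒madLe H′ H′-sparse , Sparse⇒ρ≥0 H′ H′-sparse
  where
  H′ : Adj (n + k)
  H′ = addPathAdj (adj H) u v k
  H′-sparse : Sparse H′
  H′-sparse = addPath-Sparse (adj H) u v k (madLe⇒Sparse (adj H) mad) ρ*≥7-2k
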